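{- Let $H$ be a graph possibly with loops, let $G$ be a finite multigraph without loops with an $H$-coloring $c$, and let $M_J$ be the joint matching of $L_2^H(G)$. Then there is a bijection between the set of closed dynamic $H$-trails in $G$ and the set of cycles in $L_2^H(G)$ whose edges alternate between $E(L_2^H(G))\setminus M_J$ and $M_J$.
   Context: An $H$-coloring of $G$ is a map $c:E(G)\to V(H)$. Two distinct edges of $G$ are parallel if they have the same two end vertices. A dynamic $H$-walk in $G$ is a sequence $W=(v_0,e_0^1,\ldots,e_0^{k_0},v_1,e_1^1,\ldots,v_{n-1},e_{n-1}^1,\ldots,e_{n-1}^{k_{n-1}},v_n)$ with $n\ge1$, $k_i\ge 1$, each $e_i^j$ an edge joining $v_i$ and $v_{i+1}$, such that $c(e_i^{k_i})c(e_{i+1}^1)\in E(H)$ for each $i\in\{0,\ldots,n-2\}$. A dynamic $H$-trail is one with no repeated edge; it is closed if either $v_0=v_n$ and $c(e_{n-1}^{k_{n-1}})c(e_0^1)\in E(H)$, or $v_1=v_n$ and $e_{n-1}^{k_{n-1}}$ and $e_0^1$ are parallel. Closed dynamic $H$-trails that traverse the same edges in the same cyclic order (differing only in the choice of the first edge) are regarded as the same. $L_2^H(G)$ is the simple graph with vertex set $\{f(x,e): e\in E(G),\ x \text{ an end of } e\}$, in which $f(x,e)f(y,e)$ is an edge for every edge $e$ of $G$ with ends $x,y$; $f(u,e)$ and $f(u,g)$ are adjacent iff $e\ne g$ and $c(e)c(g)\in E(H)$; and $f(u,e),f(v,g)$ with $u\ne v$ are adjacent iff $e,g$ are distinct parallel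 edges; there are no other edges. The joint matching is $M_J=\{f(x,e)f(y,e): e\in E(G)\text{ with ends }x,y\}$. -}

module Defs where

open import Data.Nat using (ℕ; zero; suc; _≤_)
open import Data.Fin using (Fin; zero; suc; inject₁; fromℕ)
open import Data.Product using (Σ; ∃; _×_; _,_; proj₁; proj₂)
open import Data.Sum using (_⊎_)
open import Data.List using (List; []; _∷_; _++_; [_]; map; zip; reverse; length; concatMap; allFin)
open import Data.List.Relation.Unary.All using (All)
open import Data.List.Relation.Unary.Unique.Propositional using (Unique)
open import Relation.Binary.PropositionalEquality using (_≡_; _≢_)
open import Relation.Nullary using (¬_)

record Graph : Set₁ where
  field
    V    : Set
    _~_  : V → V → Set
    ~-sym : ∀ {a b} → a ~ b → b ~ a

-- G : a finite multigraph without loops.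
-- Vertices Fin nV, edges Fin nE; each edge e has the two ends src e, tgt e
-- (the naming of the two ends is arbitrary; the edge is undirected).

record MultiGraph : Set where
  field
    nV nE  : ℕ
    src tgt : Fin nE → Fin nV
    noLoop  : ∀ e → src e ≢ tgt e

cycPairs : {A : Set} → List A → List (A × A)
cycPairs []       = []
cycPairs (a ∷ as) = zip (a ∷ as) (as ++ [ a ])

Rotation : {A : Set} → List A → List A → Set
Rotation {A} xs ys = Σ (List A) λ as → Σ (List A) λ bs → (xs ≡ as ++ bs) × (ys ≡ bs ++ as)

record QuotBijection {A B : Set} (_≈A_ : A → A → Set) (_≈B_ : B → B → Set) : Set where
  field
    to        : A → B
    to-cong   : ∀ {a a'} → a ≈A a' → to a ≈B to a'
    to-inj    : ∀ {a a'} → to a ≈B to a' → a ≈A a'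
    to-surj   : ∀ b → Σ A λ a → to a ≈B b

module _ (H : Graph) (G : MultiGraph) (c : Fin (MultiGraph.nE G) → Graph.V H) where
  open Graph H
  open MultiGraph G

  Joins : Fin nE → Fin nV → Fin nV → Set
  Joins e x y = (src e ≡ x × tgt e ≡ y) ⊎ (src e ≡ y × tgt e ≡ x)

  Parallel : Fin nE → Fin nE → Set
  Parallel e g = e ≢ g × ((src e ≡ src g × tgt e ≡ tgt g) ⊎ (src e ≡ tgt g × tgt e ≡ src g))

  IsEnd : Fin nV → Fin nE → Set
  IsEnd x e = x ≡ src e ⊎ x ≡ tgt e

  -- Closed dynamic H-trails  W = (v_0, e_0^1..e_0^{k_0}, v_1, ..., v_n)
  -- n = suc p  (n ≥ 1),  k_i = suc (k i)  (k_i ≥ 1),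
  -- v : Fin (n+1) → V(G),  e i j = e_i^{j+1}.

  record ClosedDynTrail : Set where
    field
      p  : ℕ
      v  : Fin (suc (suc p)) → Fin nV
      k  : Fin (suc p) → ℕ
      e  : (i : Fin (suc p)) → Fin (suc (k i)) → Fin nE
      joins : ∀ i j → Joins (e i j) (v (inject₁ i)) (v (suc i))
      dyn   : ∀ (i : Fin p) →
              c (e (inject₁ i) (fromℕ (k (inject₁ i)))) ~ c (e (suc i) zero)
      trail : ∀ (a b : Σ (Fin (suc p)) λ i → Fin (suc (k i))) →
              e (proj₁ a) (proj₂ a) ≡ e (proj₁ b) (proj₂ b) → a ≡ b
      closed : (v zero ≡ v (fromℕ (suc p)) ×
                 c (e (fromℕ p) (fromℕ (k (fromℕ p)))) ~ c (e zero zero))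
             ⊎ (v (suc zero) ≡ v (fromℕ (suc p)) ×
                 Parallel (e (fromℕ p) (fromℕ (k (fromℕ p)))) (e zero zero))

  -- the sequence of edge traversals (edge, from, to) of a trail, in order
  Traversal : Set
  Traversal = Fin nE × Fin nV × Fin nV

  traversals : ClosedDynTrail → List Traversal
  traversals T = concatMap
      (λ i → map (λ j → (e i j , v (inject₁ i) , v (suc i))) (allFin (suc (k i))))
      (allFin (suc p))
    where open ClosedDynTrail T

  reverseTraversals : List Traversal → List Traversal
  reverseTraversals ts = reverse (map (λ t → (proj₁ t , proj₂ (proj₂ t) , proj₁ (proj₂ t))) ts)

  SameTrail : ClosedDynTrail → ClosedDynTrail → Set
  SameTrail T T' = Rotation (traversals T) (traversals T')
                 ⊎ Rotation (traversals T) (reverseTraversals (traversals T'))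

  -- vertex f(x,e), x an end of e
  L2V : Set
  L2V = Σ (Fin nV × Fin nE) λ xe → IsEnd (proj₁ xe) (proj₂ xe)

  vx : L2V → Fin nV
  vx a = proj₁ (proj₁ a)

  ve : L2V → Fin nE
  ve a = proj₂ (proj₁ a)

  L2Adj : L2V → L2V → Set
  L2Adj a b =
      (ve a ≡ ve b × vx a ≢ vx b)
    ⊎ (vx a ≡ vx b × ve a ≢ ve b × c (ve a) ~ c (ve b))
    ⊎ (vx a ≢ vx b × Parallel (ve a) (ve b))

  -- the (adjacent) pair ab is an edge of the joint matching M_J
  InMJ : L2V × L2V → Set
  InMJ ab = ve (proj₁ ab) ≡ ve (proj₂ ab) × vx (proj₁ ab) ≢ vx (proj₂ ab)

  Alternate : (L2V × L2V) → (L2V × L2V) → Set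
  Alternate ab cd = (InMJ ab × ¬ InMJ cd) ⊎ (¬ InMJ ab × InMJ cd)

  record AltCycle : Set where
    field
      vs       : List L2V
      long     : 3 ≤ length vs
      distinct : Unique (map proj₁ vs)
      adjacent : All (λ ab → L2Adj (proj₁ ab) (proj₂ ab)) (cycPairs vs)
      alternating : All (λ p → Alternate (proj₁ p) (proj₂ p)) (cycPairs (cycPairs vs))

  -- cycles are the same subgraph iff their cyclic vertex sequences agree up to
  -- rotation and reversal
  SameCycle : AltCycle → AltCycle → Set
  SameCycle C C' = Rotation (map proj₁ (AltCycle.vs C)) (map proj₁ (AltCycle.vs C'))
                 ⊎ Rotation (map proj₁ (AltCycle.vs C)) (reverse (map proj₁ (AltCycle.vs C')))

module Submission where

-- Reading a closed dynamic H-trail edge by edge gives a cyclic sequence of traversals (e, a, b), with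
-- distinct edges, in which each traversal is followed either by a turn at a vertex (distinct edges with
-- H-adjacent colours) or by a parallel edge between the same two vertices; conversely every such
-- circuit is read off a closed dynamic trail. Replacing each traversal (e, a, b) by the two vertices
-- f(a, e), f(b, e) of L₂ turns a circuit into a cycle of L₂ whose edges are alternately the M_J-edge of
-- a traversal and the non-M_J edge to the next traversal, and the trail conditions are exactly the
-- adjacency conditions of L₂. Conversely the M_J-edges of an alternating cycle are every other edge, so
-- they cut the cycle into traversals. Rotations and reversals correspond on both sides; a rotation of
-- the cycle never splits an M_J-edge, since consecutive traversals use different edges.

open import Data.Nat using (ℕ; zero; suc; _≤_; s≤s; z≤n)
open import Data.Fin using (Fin; zero; suc; inject₁; fromℕ)
open import Data.Fin.Properties using (suc-injective)
open import Data.Product using (Σ; ∃; _×_; _,_; proj₁; proj₂; swap)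
open import Data.Sum using (_⊎_; inj₁; inj₂)
open import Data.Empty using (⊥; ⊥-elim)
open import Data.List using (List; []; _∷_; _++_; [_]; map; zip; reverse; length; concat; tabulate; allFin)
open import Data.List.Properties
  using (++-identityʳ; ∷-injective; ∷-injectiveˡ; unfold-reverse; reverse-++; reverse-map; length-map; map-++; map-∘;
         map-injective; concat-map; map-tabulate; tabulate-cong)
open import Data.List.Relation.Unary.All as All using (All; []; _∷_)
import Data.List.Relation.Unary.All.Properties as All
open import Data.List.Relation.Unary.AllPairs using ([]; _∷_)
import Data.List.Relation.Unary.AllPairs.Properties as AllPairs
open import Data.List.Relation.Unary.Unique.Propositional using (Unique)
import Data.List.Relation.Unary.Unique.Propositional.Properties as Unique
open import Data.List.Membership.Propositional.Properties using (∈-tabulate⁻)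
import Data.Vec.Functional as Vector
open import Relation.Binary.PropositionalEquality
  using (_≡_; _≢_; refl; sym; trans; cong; cong₂; subst; subst₂; module ≡-Reasoning)
open import Relation.Nullary using (¬_)
open import Function using (id; _∘_; _on_)
open import Defs

-- Cyclic sequences

module _ {A : Set} where

  rotate₁ : List A → List A
  rotate₁ []       = []
  rotate₁ (x ∷ xs) = xs ++ [ x ]

  All-rotate₁ : ∀ {P : A → Set} {xs} → All P xs → All P (rotate₁ xs)
  All-rotate₁ []         = []
  All-rotate₁ (px ∷ pxs) = All.++⁺ pxs (px ∷ [])

  Unique-rotate₁ : ∀ {xs} → Unique xs → Unique (rotate₁ xs)
  Unique-rotate₁ []             = []
  Unique-rotate₁ (x∉xs ∷ uniq) =
    AllPairs.++⁺ uniq ([] ∷ []) (All.map (λ x≢y → (λ y≡x → x≢y (sym y≡x)) ∷ []) x∉xs)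

module _ {A : Set} where

  Related : (A → A → Set) → A × A → Set
  Related R xy = R (proj₁ xy) (proj₂ xy)

  CyclicallyLinked : (A → A → Set) → List A → Set
  CyclicallyLinked R xs = All (Related R) (cycPairs xs)

  walkEdges : A → List A → A → List (A × A)
  walkEdges x []       w = (x , w) ∷ []
  walkEdges x (y ∷ ys) w = (x , y) ∷ walkEdges y ys w

  cycPairs-∷ : ∀ x xs → cycPairs (x ∷ xs) ≡ walkEdges x xs x
  cycPairs-∷ x xs = zip-walk x xs
    where
    zip-walk : ∀ y ys → zip (y ∷ ys) (ys ++ [ x ]) ≡ walkEdges y ys x
    zip-walk y []       = refl
    zip-walk y (z ∷ zs) = cong ((y , z) ∷_) (zip-walk z zs)

  walkEdges-++ : ∀ x ys y zs w → walkEdges x (ys ++ y ∷ zs) w ≡ walkEdges x ys y ++ walkEdges y zs w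
  walkEdges-++ x []       y zs w = refl
  walkEdges-++ x (u ∷ ys) y zs w = cong ((x , u) ∷_) (walkEdges-++ u ys y zs w)

  All-cycPairs⁺ : ∀ {P : A → Set} {xs} → All P xs → All (λ xy → P (proj₁ xy) × P (proj₂ xy)) (cycPairs xs)
  All-cycPairs⁺ []                 = []
  All-cycPairs⁺ {P} {x ∷ xs} (px ∷ pxs) = subst (All _) (sym (cycPairs-∷ x xs)) (walk px pxs)
    where
    walk : ∀ {y ys} → P y → All P ys → All (λ xy → P (proj₁ xy) × P (proj₂ xy)) (walkEdges y ys x)
    walk py []         = (py , px) ∷ []
    walk py (pz ∷ pzs) = (py , pz) ∷ walk pz pzs

  All-cycPairs⁻ : ∀ {P : A → Set} {xs} → All (λ xy → P (proj₁ xy)) (cycPairs xs) → All P xs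
  All-cycPairs⁻ {P} {[]}     _ = []
  All-cycPairs⁻ {P} {x ∷ xs} h = walk xs (subst (All _) (cycPairs-∷ x xs) h)
    where
    walk : ∀ {y w} ys → All (λ xy → P (proj₁ xy)) (walkEdges y ys w) → All P (y ∷ ys)
    walk []       (py ∷ []) = py ∷ []
    walk (z ∷ zs) (py ∷ h)  = py ∷ walk zs h

  cycPairs-middle : ∀ {P : A × A → Set} ys {y z} zs → All P (cycPairs (ys ++ y ∷ z ∷ zs)) → P (y , z)
  cycPairs-middle []       zs (p ∷ _) = p
  cycPairs-middle {P} (x ∷ ys) {y} {z} zs ps
    rewrite cycPairs-∷ x (ys ++ y ∷ z ∷ zs) | walkEdges-++ x ys y (z ∷ zs) x =
    All.head (All.++⁻ʳ (walkEdges x ys y) ps)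

  cycPairs-last : ∀ {P : A × A → Set} x ys {y} → All P (cycPairs (x ∷ ys ++ [ y ])) → P (y , x)
  cycPairs-last x ys {y} ps rewrite cycPairs-∷ x (ys ++ [ y ]) | walkEdges-++ x ys y [] x =
    All.head (All.++⁻ʳ (walkEdges x ys y) ps)

  cycPairs-rotate₁ : ∀ (xs : List A) → cycPairs (rotate₁ xs) ≡ rotate₁ (cycPairs xs)
  cycPairs-rotate₁ []           = refl
  cycPairs-rotate₁ (x ∷ [])     = refl
  cycPairs-rotate₁ (x ∷ y ∷ zs) = begin
    cycPairs (y ∷ zs ++ [ x ])       ≡⟨ cycPairs-∷ y (zs ++ [ x ]) ⟩
    walkEdges y (zs ++ [ x ]) y      ≡⟨ walkEdges-++ y zs x [] y ⟩
    walkEdges y zs x ++ [ (x , y) ]  ≡⟨ cong rotate₁ (sym (cycPairs-∷ x (y ∷ zs))) ⟩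
    rotate₁ (cycPairs (x ∷ y ∷ zs))  ∎
    where open ≡-Reasoning

  cyclicallyLinked-rotate₁ : ∀ {R : A → A → Set} {xs} → CyclicallyLinked R xs → CyclicallyLinked R (rotate₁ xs)
  cyclicallyLinked-rotate₁ {xs = xs} h = subst (All _) (sym (cycPairs-rotate₁ xs)) (All-rotate₁ h)

rotation-sym : ∀ {A : Set} {xs ys : List A} → Rotation xs ys → Rotation ys xs
rotation-sym (as , bs , xs≡ , ys≡) = bs , as , ys≡ , xs≡

pairMap : {A B : Set} → (A → B) → A × A → B × B
pairMap f xy = f (proj₁ xy) , f (proj₂ xy)

module _ {A B : Set} (f : A → B) where

  walkEdges-map : ∀ x ys w → walkEdges (f x) (map f ys) (f w) ≡ map (pairMap f) (walkEdges x ys w)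
  walkEdges-map x []       w = refl
  walkEdges-map x (y ∷ ys) w = cong (_ ∷_) (walkEdges-map y ys w)

  cycPairs-map : ∀ xs → cycPairs (map f xs) ≡ map (pairMap f) (cycPairs xs)
  cycPairs-map []       = refl
  cycPairs-map (x ∷ xs) = begin
    cycPairs (f x ∷ map f xs)            ≡⟨ cycPairs-∷ (f x) (map f xs) ⟩
    walkEdges (f x) (map f xs) (f x)     ≡⟨ walkEdges-map x xs x ⟩
    map _ (walkEdges x xs x)             ≡⟨ cong (map _) (sym (cycPairs-∷ x xs)) ⟩
    map _ (cycPairs (x ∷ xs))            ∎
    where open ≡-Reasoning

  module _ {R : B → B → Set} where

    cyclicallyLinked-map⁺ : ∀ {xs} → CyclicallyLinked (R on f) xs → CyclicallyLinked R (map f xs)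
    cyclicallyLinked-map⁺ {xs} h = subst (All (Related R)) (sym (cycPairs-map xs)) (All.map⁺ h)

    cyclicallyLinked-map⁻ : ∀ {xs} → CyclicallyLinked R (map f xs) → CyclicallyLinked (R on f) xs
    cyclicallyLinked-map⁻ {xs} h = All.map⁻ (subst (All (Related R)) (cycPairs-map xs) h)

Σ-injectiveʳ : ∀ {A : Set} {B : A → Set} {a} {b b′ : B a} → _≡_ {A = Σ A B} (a , b) (a , b′) → b ≡ b′
Σ-injectiveʳ refl = refl

inject₁≢suc : ∀ {n} (i : Fin n) → inject₁ i ≢ suc i
inject₁≢suc zero    ()
inject₁≢suc (suc i) eq = inject₁≢suc i (suc-injective eq)

TableInjective : ∀ {A : Set} {n} {k : Fin n → ℕ} → ((i : Fin n) → Fin (k i) → A) → Set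
TableInjective {n = n} {k} F =
  ∀ (a b : Σ (Fin n) λ i → Fin (k i)) → F (proj₁ a) (proj₂ a) ≡ F (proj₁ b) (proj₂ b) → a ≡ b

flattenTable : ∀ {A : Set} {n} {k : Fin n → ℕ} → ((i : Fin n) → Fin (k i) → A) → List A
flattenTable F = concat (tabulate λ i → tabulate (F i))

module _ {A : Set} where

  module _ {n} {k : Fin n → ℕ} {F : (i : Fin n) → Fin (k i) → A} where

    flattenTable-All⁺ : ∀ {P : A → Set} → (∀ i j → P (F i j)) → All P (flattenTable F)
    flattenTable-All⁺ h = All.concat⁺ (All.tabulate⁺ λ i → All.tabulate⁺ (h i))

    flattenTable-All⁻ : ∀ {P : A → Set} → All P (flattenTable F) → ∀ i j → P (F i j)
    flattenTable-All⁻ h i = All.tabulate⁻ (All.tabulate⁻ (All.concat⁻ h) i)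

    flattenTable-unique : TableInjective F → Unique (flattenTable F)
    flattenTable-unique inj = Unique.concat⁺
      (All.tabulate⁺ λ i → Unique.tabulate⁺ λ {j} {j′} eq → Σ-injectiveʳ (inj (i , j) (i , j′) eq))
      (AllPairs.tabulate⁺ λ i≢i′ (v∈row , v∈row′) → i≢i′ (same-row (∈-tabulate⁻ v∈row) (∈-tabulate⁻ v∈row′)))
      where
      same-row : ∀ {i i′ v} → ∃ (λ j → v ≡ F i j) → ∃ (λ j′ → v ≡ F i′ j′) → i ≡ i′
      same-row (j , refl) (j′ , eq) = cong proj₁ (inj (_ , j) (_ , j′) eq)

  map-flattenTable : ∀ {B : Set} (g : A → B) {n} {k : Fin n → ℕ} (F : (i : Fin n) → Fin (k i) → A) →
                     map g (flattenTable F) ≡ flattenTable (λ i j → g (F i j))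
  map-flattenTable g F = begin
    map g (concat (tabulate rows))               ≡⟨ sym (concat-map (tabulate rows)) ⟩
    concat (map (map g) (tabulate rows))         ≡⟨ cong concat (map-tabulate rows (map g)) ⟩
    concat (tabulate λ i → map g (rows i))       ≡⟨ cong concat (tabulate-cong λ i → map-tabulate (F i) g) ⟩
    concat (tabulate λ i → tabulate (g ∘ F i))   ∎
    where
    open ≡-Reasoning
    rows : Fin _ → List A
    rows i = tabulate (F i)

  module _ {R : A → A → Set} where

    row-walk : ∀ m (f : Fin (suc m) → A) {w} → (∀ (j : Fin m) → R (f (inject₁ j)) (f (suc j))) →
               R (f (fromℕ m)) w → All (Related R) (walkEdges (f zero) (tabulate (f ∘ suc)) w)
    row-walk zero    f within last = last ∷ []
    row-walk (suc m) f within last = within zero ∷ row-walk m (f ∘ suc) (within ∘ suc) last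

    table-walk : ∀ m (k : Fin (suc m) → ℕ) (F : (i : Fin (suc m)) → Fin (suc (k i)) → A) {w} →
      (∀ i (j : Fin (k i)) → R (F i (inject₁ j)) (F i (suc j))) →
      (∀ (i : Fin m) → R (F (inject₁ i) (fromℕ (k (inject₁ i)))) (F (suc i) zero)) →
      R (F (fromℕ m) (fromℕ (k (fromℕ m)))) w →
      All (Related R) (walkEdges (F zero zero) (tabulate (F zero ∘ suc) ++ flattenTable (λ i → F (suc i))) w)
    table-walk zero k F within between last
      rewrite ++-identityʳ (tabulate (F zero ∘ suc)) = row-walk (k zero) (F zero) (within zero) last
    table-walk (suc m) k F {w} within between last
      rewrite walkEdges-++ (F zero zero) (tabulate (F zero ∘ suc)) (F (suc zero) zero)
                (tabulate (F (suc zero) ∘ suc) ++ flattenTable (λ i → F (suc (suc i)))) w =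
      All.++⁺ (row-walk (k zero) (F zero) (within zero) (between zero))
              (table-walk m (k ∘ suc) (λ i → F (suc i)) (within ∘ suc) (between ∘ suc) last)

incFirst : ∀ {p} → (Fin (suc p) → ℕ) → Fin (suc p) → ℕ
incFirst k zero    = suc (k zero)
incFirst k (suc i) = k (suc i)

module _ {A : Set} {p} {k : Fin (suc p) → ℕ} where

  newRow : A → ((i : Fin (suc p)) → Fin (suc (k i)) → A) → (i : Fin (suc (suc p))) → Fin (suc ((0 Vector.∷ k) i)) → A
  newRow x F zero    zero = x
  newRow x F (suc i) j    = F i j

  newRow-injective : ∀ {x F} → TableInjective F → (∀ i j → x ≢ F i j) → TableInjective (newRow x F)
  newRow-injective inj fresh (zero  , zero) (zero   , zero) _  = refl
  newRow-injective inj fresh (zero  , zero) (suc i′ , j′)   eq = ⊥-elim (fresh i′ j′ eq)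
  newRow-injective inj fresh (suc i , j)    (zero   , zero) eq = ⊥-elim (fresh i j (sym eq))
  newRow-injective inj fresh (suc i , j)    (suc i′ , j′)   eq with inj (i , j) (i′ , j′) eq
  ... | refl = refl

  consFirst : A → ((i : Fin (suc p)) → Fin (suc (k i)) → A) → (i : Fin (suc p)) → Fin (suc (incFirst k i)) → A
  consFirst x F zero    zero    = x
  consFirst x F zero    (suc j) = F zero j
  consFirst x F (suc i) j       = F (suc i) j

  consFirst-injective : ∀ {x F} → TableInjective F → (∀ i j → x ≢ F i j) → TableInjective (consFirst x F)
  consFirst-injective inj fresh (zero  , zero)  (zero   , zero)   _  = refl
  consFirst-injective inj fresh (zero  , zero)  (zero   , suc j′) eq = ⊥-elim (fresh zero j′ eq)
  consFirst-injective inj fresh (zero  , zero)  (suc i′ , j′)     eq = ⊥-elim (fresh (suc i′) j′ eq)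
  consFirst-injective inj fresh (zero  , suc j) (zero   , zero)   eq = ⊥-elim (fresh zero j (sym eq))
  consFirst-injective inj fresh (suc i , j)     (zero   , zero)   eq = ⊥-elim (fresh (suc i) j (sym eq))
  consFirst-injective inj fresh (zero  , suc j) (zero   , suc j′) eq with inj (zero , j) (zero , j′) eq
  ... | refl = refl
  consFirst-injective inj fresh (zero  , suc j) (suc i′ , j′)     eq with inj (zero , j) (suc i′ , j′) eq
  ... | ()
  consFirst-injective inj fresh (suc i , j)     (zero   , suc j′) eq with inj (suc i , j) (zero , j′) eq
  ... | ()
  consFirst-injective inj fresh (suc i , j)     (suc i′ , j′)     eq with inj (suc i , j) (suc i′ , j′) eq
  ... | refl = refl

consFirst-last : ∀ {A : Set} p {k : Fin (suc p) → ℕ} (x : A) (F : (i : Fin (suc p)) → Fin (suc (k i)) → A) →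
                 consFirst x F (fromℕ p) (fromℕ (incFirst k (fromℕ p))) ≡ F (fromℕ p) (fromℕ (k (fromℕ p)))
consFirst-last zero    x F = refl
consFirst-last (suc p) x F = refl

-- Lists of pairs

bridge : {A : Set} → (A × A) × (A × A) → (A × A) × (A × A)
bridge (p , q) = p , (proj₂ p , proj₁ q)

unpairs : {A : Set} → List (A × A) → List A
unpairs []             = []
unpairs ((x , y) ∷ ps) = x ∷ y ∷ unpairs ps

module _ {A : Set} where

  unpairs-++ : ∀ (ps qs : List (A × A)) → unpairs (ps ++ qs) ≡ unpairs ps ++ unpairs qs
  unpairs-++ []             qs = refl
  unpairs-++ ((x , y) ∷ ps) qs = cong (λ l → x ∷ y ∷ l) (unpairs-++ ps qs)

  unpairs-injective : ∀ {ps qs : List (A × A)} → unpairs ps ≡ unpairs qs → ps ≡ qs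
  unpairs-injective {[]}    {[]}    _  = refl
  unpairs-injective {_ ∷ _} {_ ∷ _} eq with ∷-injective eq
  ... | refl , eq′ with ∷-injective eq′
  ... | refl , eq″ = cong (_ ∷_) (unpairs-injective eq″)

  reverse-unpairs : ∀ (ps : List (A × A)) → reverse (unpairs ps) ≡ unpairs (reverse (map swap ps))
  reverse-unpairs []             = refl
  reverse-unpairs ((x , y) ∷ ps) = begin
    reverse (x ∷ y ∷ unpairs ps)                           ≡⟨ reverse-++ (x ∷ y ∷ []) (unpairs ps) ⟩
    reverse (unpairs ps) ++ y ∷ x ∷ []                     ≡⟨ cong (_++ y ∷ x ∷ []) (reverse-unpairs ps) ⟩
    unpairs (reverse (map swap ps)) ++ unpairs [ (y , x) ] ≡⟨ sym (unpairs-++ (reverse (map swap ps)) _) ⟩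
    unpairs (reverse (map swap ps) ++ [ (y , x) ])
      ≡⟨ cong unpairs (sym (unfold-reverse (y , x) (map swap ps))) ⟩
    unpairs (reverse (map swap ((x , y) ∷ ps)))             ∎
    where open ≡-Reasoning

  module _ {P : A → Set} where

    All-unpairs⁺ : ∀ {ps : List (A × A)} → All (λ p → P (proj₁ p) × P (proj₂ p)) ps → All P (unpairs ps)
    All-unpairs⁺ []              = []
    All-unpairs⁺ ((px , py) ∷ h) = px ∷ py ∷ All-unpairs⁺ h

    All-unpairs⁻ : ∀ (ps : List (A × A)) → All P (unpairs ps) → All (λ p → P (proj₁ p) × P (proj₂ p)) ps
    All-unpairs⁻ []      _              = []
    All-unpairs⁻ (_ ∷ ps) (px ∷ py ∷ h) = (px , py) ∷ All-unpairs⁻ ps h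

  cycPairs-unpairs : ∀ (ps : List (A × A)) → cycPairs (unpairs ps) ≡ unpairs (map bridge (cycPairs ps))
  cycPairs-unpairs []             = refl
  cycPairs-unpairs ((x , y) ∷ ps) = begin
    cycPairs (x ∷ y ∷ unpairs ps)                         ≡⟨ cycPairs-∷ x (y ∷ unpairs ps) ⟩
    (x , y) ∷ walkEdges y (unpairs ps) x                  ≡⟨ walk ps ⟩
    unpairs (map bridge (walkEdges (x , y) ps (x , y)))
      ≡⟨ cong (unpairs ∘ map bridge) (sym (cycPairs-∷ (x , y) ps)) ⟩
    unpairs (map bridge (cycPairs ((x , y) ∷ ps)))        ∎
    where
    open ≡-Reasoning
    walk : ∀ {u v} qs → (u , v) ∷ walkEdges v (unpairs qs) x ≡ unpairs (map bridge (walkEdges (u , v) qs (x , y)))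
    walk []             = refl
    walk ((u , v) ∷ qs) = cong (λ l → _ ∷ _ ∷ l) (walk qs)

module _ {A : Set} (P : A → Set) where

  Alternates : A → A → Set
  Alternates x y = (P x × ¬ P y) ⊎ (¬ P x × P y)

  alternating-unpairs⁺ : ∀ {es : List (A × A)} → All (λ e → P (proj₁ e) × ¬ P (proj₂ e)) es →
                         CyclicallyLinked Alternates (unpairs es)
  alternating-unpairs⁺ {es} h = subst (All (Related Alternates)) (sym (cycPairs-unpairs es))
    (All-unpairs⁺ (All.map⁺ (All.map (λ where ((p₁ , ¬p₂) , (p₃ , _)) → inj₁ (p₁ , ¬p₂) , inj₂ (¬p₂ , p₃))
                                     (All-cycPairs⁺ h))))

  alternating-unpairs⁻ : ∀ {es : List (A × A)} → All (λ e → P (proj₁ e)) es →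
                         CyclicallyLinked Alternates (unpairs es) → All (λ e → ¬ P (proj₂ e)) es
  alternating-unpairs⁻ {es} firsts h = All.zipWith second-off (firsts , All-cycPairs⁻ (All.map proj₁
    (All.map⁻ (All-unpairs⁻ (map bridge (cycPairs es)) (subst (All (Related Alternates)) (cycPairs-unpairs es) h)))))
    where
    second-off : ∀ {e} → P (proj₁ e) × Related Alternates e → ¬ P (proj₂ e)
    second-off (_  , inj₁ (_ , ¬p)) = ¬p
    second-off (p₁ , inj₂ (¬p₁ , _)) = ⊥-elim (¬p₁ p₁)

module _ {B : Set} (P : B × B → Set) where

  private
    off-next : ∀ {a b} → P a → Alternates P a b → ¬ P b
    off-next _  (inj₁ (_ , ¬pb)) = ¬pb
    off-next pa (inj₂ (¬pa , _)) = ⊥-elim (¬pa pa)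

    on-next : ∀ {a b} → ¬ P a → Alternates P a b → P b
    on-next ¬pa (inj₁ (pa , _)) = ⊥-elim (¬pa pa)
    on-next _   (inj₂ (_ , pb)) = pb

    pairing : ∀ {x y} zs {u v} → P (x , y) → P (u , v) →
              All (Related (Alternates P)) (walkEdges (x , y) (walkEdges y zs u) (u , v)) →
              ∃ λ ps → x ∷ y ∷ zs ≡ unpairs ps × All P ps
    pairing []           pxy _   _                    = [ (_ , _) ] , refl , pxy ∷ []
    pairing (z ∷ [])     pxy puv (a₁ ∷ a₂ ∷ a₃ ∷ []) = ⊥-elim (off-next (on-next (off-next pxy a₁) a₂) a₃ puv)
    pairing (z ∷ w ∷ zs) pxy puv (a₁ ∷ a₂ ∷ alt) with pairing zs (on-next (off-next pxy a₁) a₂) puv alt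
    ... | ps , eq , pps = (_ , _) ∷ ps , cong (λ l → _ ∷ _ ∷ l) eq , pxy ∷ pps

  matched-pairs : ∀ {x y} zs → P (x , y) → CyclicallyLinked (Alternates P) (cycPairs (x ∷ y ∷ zs)) →
                  ∃ λ ps → x ∷ y ∷ zs ≡ unpairs ps × All P ps
  matched-pairs {x} {y} zs pxy alt = pairing zs pxy pxy (subst (All _) edges alt)
    where
    edges : cycPairs (cycPairs (x ∷ y ∷ zs)) ≡ walkEdges (x , y) (walkEdges y zs x) (x , y)
    edges = trans (cong cycPairs (cycPairs-∷ x (y ∷ zs))) (cycPairs-∷ (x , y) (walkEdges y zs x))

module _ {T A : Set} (f : T → A × A) where

  private
    data Split (ts : List T) (as bs : List A) : Set where
      even : ∀ us ws → ts ≡ us ++ ws → as ≡ unpairs (map f us) → bs ≡ unpairs (map f ws) → Split ts as bs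
      odd  : ∀ us t ws → ts ≡ us ++ t ∷ ws → as ≡ unpairs (map f us) ++ [ proj₁ (f t) ] →
             bs ≡ proj₂ (f t) ∷ unpairs (map f ws) → Split ts as bs

    split : ∀ ts as bs → unpairs (map f ts) ≡ as ++ bs → Split ts as bs
    split ts       []           bs eq = even [] ts refl refl (sym eq)
    split (t ∷ ts) (a ∷ [])     bs eq with ∷-injective eq
    ... | refl , eq′ = odd [] t ts refl refl (sym eq′)
    split (t ∷ ts) (a ∷ a′ ∷ as) bs eq with ∷-injective eq
    ... | refl , eq′ with ∷-injective eq′
    ... | refl , eq″ with split ts as bs eq″
    ... | even us ws refl refl refl    = even (t ∷ us) ws refl refl refl
    ... | odd us u ws refl refl refl = odd (t ∷ us) u ws refl refl refl

  -- A rotation of unpairs (map f ts) that cuts through a pair would pair up the second half of one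
  -- pair with the first half of the next one; Q separates the two kinds of pairs.
  unpairs-rotation : (Q : A × A → Set) → (∀ t → Q (f t)) → (∀ {t t′} → f t ≡ f t′ → t ≡ t′) →
    ∀ {ts us as bs} → All (λ tt′ → ¬ Q (proj₂ (f (proj₁ tt′)) , proj₁ (f (proj₂ tt′)))) (cycPairs ts) →
    unpairs (map f ts) ≡ as ++ bs → unpairs (map f us) ≡ bs ++ as → Rotation ts us
  unpairs-rotation Q Qf f-injective {ts} {us} {as} {bs} gaps eq₁ eq₂ with split ts as bs eq₁
  ... | even vs ws refl refl refl =
    vs , ws , refl , map-injective f-injective (unpairs-injective (trans eq₂ (sym unpairs-map-++)))
    where
    unpairs-map-++ : unpairs (map f (ws ++ vs)) ≡ unpairs (map f ws) ++ unpairs (map f vs)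
    unpairs-map-++ = trans (cong unpairs (map-++ f ws vs)) (unpairs-++ (map f ws) (map f vs))
  ... | odd vs t ws refl refl refl = ⊥-elim (crossing vs ws gaps eq₂)
    where
    first-pair : ∀ {a b rest} us → unpairs (map f us) ≡ a ∷ b ∷ rest → Q (a , b)
    first-pair (u ∷ _) eq with ∷-injective eq
    ... | refl , eq′ with ∷-injective eq′
    ... | refl , _ = Qf u
    crossing : ∀ vs ws → All _ (cycPairs (vs ++ t ∷ ws)) →
               unpairs (map f us) ≡ (proj₂ (f t) ∷ unpairs (map f ws)) ++ (unpairs (map f vs) ++ [ proj₁ (f t) ]) → ⊥
    crossing vs       (w ∷ ws) gaps eq = cycPairs-middle vs ws gaps (first-pair us eq)
    crossing (v ∷ vs) []       gaps eq = cycPairs-last v vs gaps (first-pair us eq)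
    crossing []       []       gaps eq = All.head gaps (first-pair us eq)

map-proj₁-toList : ∀ {A : Set} {P : A → Set} {xs} (pxs : All P xs) → map proj₁ (All.toList pxs) ≡ xs
map-proj₁-toList []         = refl
map-proj₁-toList (px ∷ pxs) = cong (_ ∷_) (map-proj₁-toList pxs)

-- Closed dynamic trails and alternating cycles

module Correspondence (H : Graph) (G : MultiGraph) (c : Fin (MultiGraph.nE G) → Graph.V H) where
  open Graph H
  open MultiGraph G

  Trav : Set
  Trav = Traversal H G c

  edge : Trav → Fin nE
  edge = proj₁

  start end : Trav → Fin nV
  start t = proj₁ (proj₂ t)
  end   t = proj₂ (proj₂ t)

  Node : Set
  Node = Fin nV × Fin nE

  startNode endNode : Trav → Node
  startNode t = start t , edge t
  endNode   t = end t , edge t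

  nodePair : Trav → Node × Node
  nodePair t = startNode t , endNode t

  -- the vertices f(a, e) f(b, e) of L₂ visited while traversing e from a to b
  nodes : List Trav → List Node
  nodes ts = unpairs (map nodePair ts)

  Traverses : Trav → Set
  Traverses t = Joins H G c (edge t) (start t) (end t)

  -- Consecutive traversals of a dynamic trail: a turn at a vertex between two blocks e_i^{k_i}, e_{i+1}^1,
  -- or a step to a parallel edge inside a block.
  data Link (t u : Trav) : Set where
    turn     : end t ≡ start u → edge t ≢ edge u → c (edge t) ~ c (edge u) → Link t u
    parallel : start t ≡ start u → end t ≡ end u → Parallel H G c (edge t) (edge u) → Link t u

  record IsCircuit (ts : List Trav) : Set where
    field
      traverse       : All Traverses ts
      edges-distinct : Unique (map edge ts)
      linked         : CyclicallyLinked Link ts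

  IsEndNode : Node → Set
  IsEndNode x = IsEnd H G c (proj₁ x) (proj₂ x)

  Matched : Node × Node → Set
  Matched xy = proj₂ (proj₁ xy) ≡ proj₂ (proj₂ xy) × proj₁ (proj₁ xy) ≢ proj₁ (proj₂ xy)

  Adjacent : Node → Node → Set
  Adjacent x y = Matched (x , y)
               ⊎ (proj₁ x ≡ proj₁ y × proj₂ x ≢ proj₂ y × c (proj₂ x) ~ c (proj₂ y))
               ⊎ (proj₁ x ≢ proj₁ y × Parallel H G c (proj₂ x) (proj₂ y))

  record IsAltCycle (ns : List Node) : Set where
    field
      ends        : All IsEndNode ns
      long        : 3 ≤ length ns
      distinct    : Unique ns
      adjacent    : CyclicallyLinked Adjacent ns
      alternating : CyclicallyLinked (Alternates Matched) (cycPairs ns)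

  joins⇒≢ : ∀ {e a b} → Joins H G c e a b → a ≢ b
  joins⇒≢ {e} (inj₁ (s , t)) a≡b = noLoop e (trans s (trans a≡b (sym t)))
  joins⇒≢ {e} (inj₂ (s , t)) a≡b = noLoop e (trans s (trans (sym a≡b) (sym t)))

  joins-isEndˡ : ∀ {e a b} → Joins H G c e a b → IsEnd H G c a e
  joins-isEndˡ (inj₁ (s , _)) = inj₁ (sym s)
  joins-isEndˡ (inj₂ (_ , t)) = inj₂ (sym t)

  joins-isEndʳ : ∀ {e a b} → Joins H G c e a b → IsEnd H G c b e
  joins-isEndʳ (inj₁ (_ , t)) = inj₂ (sym t)
  joins-isEndʳ (inj₂ (s , _)) = inj₁ (sym s)

  isEnd⇒endpoint : ∀ {e a b x} → Joins H G c e a b → IsEnd H G c x e → x ≡ a ⊎ x ≡ b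
  isEnd⇒endpoint (inj₁ (s , _)) (inj₁ x≡) = inj₁ (trans x≡ s)
  isEnd⇒endpoint (inj₁ (_ , t)) (inj₂ x≡) = inj₂ (trans x≡ t)
  isEnd⇒endpoint (inj₂ (s , _)) (inj₁ x≡) = inj₂ (trans x≡ s)
  isEnd⇒endpoint (inj₂ (_ , t)) (inj₂ x≡) = inj₁ (trans x≡ t)

  isEnds⇒joins : ∀ {e a b} → IsEnd H G c a e → IsEnd H G c b e → a ≢ b → Joins H G c e a b
  isEnds⇒joins (inj₁ a≡) (inj₁ b≡) a≢b = ⊥-elim (a≢b (trans a≡ (sym b≡)))
  isEnds⇒joins (inj₁ a≡) (inj₂ b≡) _   = inj₁ (sym a≡ , sym b≡)
  isEnds⇒joins (inj₂ a≡) (inj₁ b≡) _   = inj₂ (sym b≡ , sym a≡)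
  isEnds⇒joins (inj₂ a≡) (inj₂ b≡) a≢b = ⊥-elim (a≢b (trans a≡ (sym b≡)))

  parallel-isEnd : ∀ {e e′ x} → Parallel H G c e e′ → IsEnd H G c x e → IsEnd H G c x e′
  parallel-isEnd (_ , inj₁ (s , _)) (inj₁ x≡) = inj₁ (trans x≡ s)
  parallel-isEnd (_ , inj₁ (_ , t)) (inj₂ x≡) = inj₂ (trans x≡ t)
  parallel-isEnd (_ , inj₂ (s , _)) (inj₁ x≡) = inj₂ (trans x≡ s)
  parallel-isEnd (_ , inj₂ (_ , t)) (inj₂ x≡) = inj₁ (trans x≡ t)

  joins⇒parallel : ∀ {e e′ a b} → Joins H G c e a b → Joins H G c e′ a b → e ≢ e′ → Parallel H G c e e′
  joins⇒parallel (inj₁ (s , t)) (inj₁ (s′ , t′)) e≢e′ = e≢e′ , inj₁ (trans s (sym s′) , trans t (sym t′))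
  joins⇒parallel (inj₁ (s , t)) (inj₂ (s′ , t′)) e≢e′ = e≢e′ , inj₂ (trans s (sym t′) , trans t (sym s′))
  joins⇒parallel (inj₂ (s , t)) (inj₁ (s′ , t′)) e≢e′ = e≢e′ , inj₂ (trans s (sym t′) , trans t (sym s′))
  joins⇒parallel (inj₂ (s , t)) (inj₂ (s′ , t′)) e≢e′ = e≢e′ , inj₁ (trans s (sym s′) , trans t (sym t′))

  module _ {e a b e′ a′ b′} (j : Joins H G c e a b) (j′ : Joins H G c e′ a′ b′) (par : Parallel H G c e e′) where

    parallel-sameStart : b ≡ b′ → a ≡ a′
    parallel-sameStart b≡b′ with isEnd⇒endpoint j′ (parallel-isEnd par (joins-isEndˡ j))
    ... | inj₁ a≡a′ = a≡a′
    ... | inj₂ a≡b′ = ⊥-elim (joins⇒≢ j (trans a≡b′ (sym b≡b′)))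

    parallel-aligned : b ≢ a′ → a ≡ a′ × b ≡ b′
    parallel-aligned b≢a′ with isEnd⇒endpoint j′ (parallel-isEnd par (joins-isEndʳ j))
    ... | inj₁ b≡a′ = ⊥-elim (b≢a′ b≡a′)
    ... | inj₂ b≡b′ = parallel-sameStart b≡b′ , b≡b′

  link⇒edge≢ : ∀ {t u} → Link t u → edge t ≢ edge u
  link⇒edge≢ (turn _ e≢e′ _)     = e≢e′
  link⇒edge≢ (parallel _ _ par) = proj₁ par

  traverses⇒matched : ∀ {t} → Traverses t → Matched (nodePair t)
  traverses⇒matched jt = refl , joins⇒≢ jt

  link⇒adjacent : ∀ {t u} → Traverses u → Link t u → Adjacent (endNode t) (startNode u)
  link⇒adjacent ju (turn t→u e≢e′ colours) = inj₂ (inj₁ (t→u , e≢e′ , colours))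
  link⇒adjacent ju (parallel _ end≡ par)   = inj₂ (inj₂ ((λ t→u → joins⇒≢ ju (trans (sym t→u) end≡)) , par))

  adjacent⇒link : ∀ {t u} → Traverses t → Traverses u → Adjacent (endNode t) (startNode u) →
                  ¬ Matched (endNode t , startNode u) → Link t u
  adjacent⇒link jt ju (inj₁ m)                             ¬m = ⊥-elim (¬m m)
  adjacent⇒link jt ju (inj₂ (inj₁ (t→u , e≢e′ , colours))) _  = turn t→u e≢e′ colours
  adjacent⇒link jt ju (inj₂ (inj₂ (t≢u , par)))            _  with parallel-aligned jt ju par t≢u
  ... | start≡ , end≡ = parallel start≡ end≡ par

  linkEdge : Trav × Trav → Node × Node
  linkEdge tu = endNode (proj₁ tu) , startNode (proj₂ tu)

  nodeEdges : List Trav → List ((Node × Node) × (Node × Node))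
  nodeEdges ts = map (λ tu → nodePair (proj₁ tu) , linkEdge tu) (cycPairs ts)

  cycPairs-nodes : ∀ ts → cycPairs (nodes ts) ≡ unpairs (nodeEdges ts)
  cycPairs-nodes ts = trans (cycPairs-unpairs (map nodePair ts))
    (cong unpairs (trans (cong (map bridge) (cycPairs-map nodePair ts)) (sym (map-∘ (cycPairs ts)))))

  module _ {R : Node → Node → Set} {ts : List Trav} where

    cyclicallyLinked-nodes⁺ : All (λ tu → Related R (nodePair (proj₁ tu)) × Related R (linkEdge tu)) (cycPairs ts) →
                              CyclicallyLinked R (nodes ts)
    cyclicallyLinked-nodes⁺ h = subst (All (Related R)) (sym (cycPairs-nodes ts)) (All-unpairs⁺ (All.map⁺ h))

    cyclicallyLinked-nodes⁻ : CyclicallyLinked R (nodes ts) →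
                              All (λ tu → Related R (nodePair (proj₁ tu)) × Related R (linkEdge tu)) (cycPairs ts)
    cyclicallyLinked-nodes⁻ h = All.map⁻ (All-unpairs⁻ (nodeEdges ts) (subst (All (Related R)) (cycPairs-nodes ts) h))

  module _ {ts : List Trav} where

    alternating-nodes⁺ : All (λ tu → Matched (nodePair (proj₁ tu)) × ¬ Matched (linkEdge tu)) (cycPairs ts) →
                         CyclicallyLinked (Alternates Matched) (cycPairs (nodes ts))
    alternating-nodes⁺ h =
      subst (CyclicallyLinked _) (sym (cycPairs-nodes ts)) (alternating-unpairs⁺ Matched (All.map⁺ h))

    alternating-nodes⁻ : All (λ tu → Matched (nodePair (proj₁ tu))) (cycPairs ts) →
                         CyclicallyLinked (Alternates Matched) (cycPairs (nodes ts)) →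
                         All (λ tu → ¬ Matched (linkEdge tu)) (cycPairs ts)
    alternating-nodes⁻ matched h = All.map⁻
      (alternating-unpairs⁻ Matched (All.map⁺ matched) (subst (CyclicallyLinked _) (cycPairs-nodes ts) h))

  nodes-unique : ∀ {ts} → All Traverses ts → Unique (map edge ts) → Unique (nodes ts)
  nodes-unique [] [] = []
  nodes-unique {t ∷ ts} (jt ∷ jts) (t∉ts ∷ uniq) =
    ((joins⇒≢ jt ∘ cong proj₁) ∷ elsewhere) ∷ elsewhere ∷ nodes-unique jts uniq
    where
    elsewhere : ∀ {x} → All ((x , edge t) ≢_) (nodes ts)
    elsewhere = All-unpairs⁺ (All.map⁺ (All.map (λ e≢ → (e≢ ∘ cong proj₂) , (e≢ ∘ cong proj₂)) (All.map⁻ t∉ts)))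

  nodes⇒traverse : ∀ ts → All IsEndNode (nodes ts) → Unique (nodes ts) → All Traverses ts
  nodes⇒traverse [] _ _ = []
  nodes⇒traverse (t ∷ ts) (s-end ∷ e-end ∷ ends) ((s≢e ∷ _) ∷ _ ∷ uniq) =
    isEnds⇒joins s-end e-end (λ s≡e → s≢e (cong (_, edge t) s≡e)) ∷ nodes⇒traverse ts ends uniq

  nodes⇒edges-distinct : ∀ {ts} → All Traverses ts → Unique (nodes ts) → Unique (map edge ts)
  nodes⇒edges-distinct [] _ = []
  nodes⇒edges-distinct {t ∷ ts} (jt ∷ jts) ((_ ∷ start∉) ∷ end∉ ∷ uniq) =
    All.map⁺ (All.zipWith edge-apart (jts , All.zip (apart start∉ , apart end∉))) ∷ nodes⇒edges-distinct jts uniq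
    where
    apart : ∀ {x} → All (x ≢_) (nodes ts) → All (λ u → x ≢ startNode u × x ≢ endNode u) ts
    apart x∉ = All.map⁻ (All-unpairs⁻ (map nodePair ts) x∉)
    -- u starts at an end of its edge; if that edge were edge t, u would start at an end of t
    edge-apart : ∀ {u} → Traverses u × (startNode t ≢ startNode u × _) × (endNode t ≢ startNode u × _) →
                 edge t ≢ edge u
    edge-apart {u} (ju , (s≢s , _) , (e≢s , _)) t≡u
      with isEnd⇒endpoint jt (subst (IsEnd H G c (start u)) (sym t≡u) (joins-isEndˡ ju))
    ... | inj₁ u≡s = s≢s (cong₂ _,_ (sym u≡s) t≡u)
    ... | inj₂ u≡e = e≢s (cong₂ _,_ (sym u≡e) t≡u)

  circuit⇒isAltCycle : ∀ {t ts} → IsCircuit (t ∷ ts) → IsAltCycle (nodes (t ∷ ts))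
  circuit⇒isAltCycle {t} {ts} circuit = record
    { ends        = All-unpairs⁺ (All.map⁺ (All.map (λ j → joins-isEndˡ j , joins-isEndʳ j) traverse))
    ; long        = long ts linked
    ; distinct    = nodes-unique traverse edges-distinct
    ; adjacent    = cyclicallyLinked-nodes⁺
                      (All.map (λ (jt , ju , l) → inj₁ (traverses⇒matched jt) , link⇒adjacent ju l) steps)
    ; alternating = alternating-nodes⁺ (All.map (λ (jt , _ , l) → traverses⇒matched jt , link⇒edge≢ l ∘ proj₁) steps)
    }
    where
    open IsCircuit circuit
    steps : All (λ tu → Traverses (proj₁ tu) × Traverses (proj₂ tu) × Related Link tu) (cycPairs (t ∷ ts))
    steps = All.zipWith (λ ((jt , ju) , l) → jt , ju , l) (All-cycPairs⁺ traverse , linked)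
    long : ∀ ts → CyclicallyLinked Link (t ∷ ts) → 3 ≤ length (nodes (t ∷ ts))
    long []      (l ∷ []) = ⊥-elim (link⇒edge≢ l refl)
    long (_ ∷ _) _        = s≤s (s≤s (s≤s z≤n))

  isAltCycle⇒circuit : ∀ {ts} → IsAltCycle (nodes ts) → IsCircuit ts
  isAltCycle⇒circuit {ts} cycle = record
    { traverse       = traverse
    ; edges-distinct = nodes⇒edges-distinct traverse distinct
    ; linked         = All.zipWith (λ (((jt , ju) , (_ , adj)) , ¬m) → adjacent⇒link jt ju adj ¬m)
                         (All.zip (steps , cyclicallyLinked-nodes⁻ {ts = ts} adjacent) ,
                          alternating-nodes⁻ {ts} (All.map (traverses⇒matched ∘ proj₁) steps) alternating)
    }
    where
    open IsAltCycle cycle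
    traverse : All Traverses ts
    traverse = nodes⇒traverse ts ends distinct
    steps : All (λ tu → Traverses (proj₁ tu) × Traverses (proj₂ tu)) (cycPairs ts)
    steps = All-cycPairs⁺ traverse

  isAltCycle : (C : AltCycle H G c) → IsAltCycle (map proj₁ (AltCycle.vs C))
  isAltCycle C = record
    { ends        = All.fromList vs
    ; long        = subst (3 ≤_) (sym (length-map proj₁ vs)) long
    ; distinct    = distinct
    ; adjacent    = cyclicallyLinked-map⁺ proj₁ {xs = vs} adjacent
    ; alternating = subst (CyclicallyLinked _) (sym (cycPairs-map proj₁ vs))
                      (cyclicallyLinked-map⁺ (pairMap proj₁) {xs = cycPairs vs} alternating)
    }
    where open AltCycle C

  altCycle : ∀ {ns} → IsAltCycle ns → Σ (AltCycle H G c) λ C → map proj₁ (AltCycle.vs C) ≡ ns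
  altCycle {ns} cycle = record
    { vs          = vs
    ; long        = subst (3 ≤_) (length-map proj₁ vs) long
    ; distinct    = distinct
    ; adjacent    = cyclicallyLinked-map⁻ proj₁ {xs = vs} adjacent
    ; alternating = cyclicallyLinked-map⁻ (pairMap proj₁) {xs = cycPairs vs}
                      (subst (CyclicallyLinked _) (cycPairs-map proj₁ vs) alternating)
    } , vs-nodes
    where
    vs : List (L2V H G c)
    vs = All.toList (IsAltCycle.ends cycle)
    vs-nodes : map proj₁ vs ≡ ns
    vs-nodes = map-proj₁-toList (IsAltCycle.ends cycle)
    open IsAltCycle (subst IsAltCycle (sym vs-nodes) cycle)

  isAltCycle-rotate₁ : ∀ {x y z r} → IsAltCycle (x ∷ y ∷ z ∷ r) → IsAltCycle (y ∷ z ∷ r ++ [ x ])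
  isAltCycle-rotate₁ {x} {y} {z} {r} cycle = record
    { ends        = All-rotate₁ ends
    ; long        = long′ r
    ; distinct    = Unique-rotate₁ distinct
    ; adjacent    = cyclicallyLinked-rotate₁ {xs = x ∷ y ∷ z ∷ r} adjacent
    ; alternating = subst (CyclicallyLinked _) (sym (cycPairs-rotate₁ (x ∷ y ∷ z ∷ r)))
                      (cyclicallyLinked-rotate₁ {xs = cycPairs (x ∷ y ∷ z ∷ r)} alternating)
    }
    where
    open IsAltCycle cycle
    long′ : ∀ r → 3 ≤ length (y ∷ z ∷ r ++ [ x ])
    long′ []      = s≤s (s≤s (s≤s z≤n))
    long′ (_ ∷ _) = s≤s (s≤s (s≤s z≤n))

  startAtMatched : ∀ {ns} → IsAltCycle ns →
                   ∃ λ x → ∃ λ y → ∃ λ zs → Rotation ns (x ∷ y ∷ zs) × IsAltCycle (x ∷ y ∷ zs) × Matched (x , y)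
  startAtMatched cycle = atMatched (IsAltCycle.long cycle) cycle
    where
    atMatched : ∀ {ns} → 3 ≤ length ns → IsAltCycle ns →
                ∃ λ x → ∃ λ y → ∃ λ zs → Rotation ns (x ∷ y ∷ zs) × IsAltCycle (x ∷ y ∷ zs) × Matched (x , y)
    atMatched {x ∷ y ∷ z ∷ r} (s≤s (s≤s (s≤s _))) cycle with All.head (IsAltCycle.alternating cycle)
    ... | inj₁ (m , _) = x , y , z ∷ r , ([] , _ , refl , sym (++-identityʳ _)) , cycle , m
    ... | inj₂ (_ , m) = y , z , r ++ [ x ] , ([ x ] , _ , refl , refl) , isAltCycle-rotate₁ cycle , m

  traversalOf : Node × Node → Trav
  traversalOf (x , y) = proj₂ x , proj₁ x , proj₁ y

  nodes-traversalOf : ∀ {ps} → All Matched ps → nodes (map traversalOf ps) ≡ unpairs ps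
  nodes-traversalOf []                                 = refl
  nodes-traversalOf {(x , y) ∷ _} ((same-edge , _) ∷ ms) =
    cong₂ (λ y′ l → x ∷ y′ ∷ l) (cong (proj₁ y ,_) same-edge) (nodes-traversalOf ms)

  isAltCycle⇒rotatedCircuit : ∀ {ns} → IsAltCycle ns →
                              ∃ λ t → ∃ λ ts → IsCircuit (t ∷ ts) × Rotation ns (nodes (t ∷ ts))
  isAltCycle⇒rotatedCircuit {ns} cycle with startAtMatched cycle
  ... | x , y , zs , rotation , cycle′ , m with matched-pairs Matched zs m (IsAltCycle.alternating cycle′)
  ... | p ∷ ps , eq , matched = traversalOf p , map traversalOf ps ,
        isAltCycle⇒circuit (subst IsAltCycle ns≡ cycle′) , subst (Rotation ns) ns≡ rotation
    where
    ns≡ : x ∷ y ∷ zs ≡ nodes (map traversalOf (p ∷ ps))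
    ns≡ = trans eq (sym (nodes-traversalOf matched))

  nodes-++ : ∀ ts us → nodes (ts ++ us) ≡ nodes ts ++ nodes us
  nodes-++ ts us = trans (cong unpairs (map-++ nodePair ts us)) (unpairs-++ (map nodePair ts) (map nodePair us))

  nodes-reverse : ∀ ts → reverse (nodes ts) ≡ nodes (reverseTraversals H G c ts)
  nodes-reverse ts = begin
    reverse (unpairs (map nodePair ts))                 ≡⟨ reverse-unpairs (map nodePair ts) ⟩
    unpairs (reverse (map swap (map nodePair ts)))      ≡⟨ cong (unpairs ∘ reverse) (sym (map-∘ ts)) ⟩
    unpairs (reverse (map (nodePair ∘ flip) ts))        ≡⟨ cong (unpairs ∘ reverse) (map-∘ ts) ⟩
    unpairs (reverse (map nodePair (map flip ts)))      ≡⟨ cong unpairs (sym (reverse-map nodePair (map flip ts))) ⟩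
    unpairs (map nodePair (reverse (map flip ts)))      ∎
    where
    open ≡-Reasoning
    flip : Trav → Trav
    flip t = edge t , end t , start t

  rotation-nodes : ∀ {ts us} → Rotation ts us → Rotation (nodes ts) (nodes us)
  rotation-nodes (as , bs , refl , refl) = nodes as , nodes bs , nodes-++ as bs , nodes-++ bs as

  nodePair-injective : ∀ {t u} → nodePair t ≡ nodePair u → t ≡ u
  nodePair-injective refl = refl

  nodes-rotation : ∀ {ts us} → CyclicallyLinked Link ts → Rotation (nodes ts) (nodes us) → Rotation ts us
  nodes-rotation linked (as , bs , eq₁ , eq₂) =
    unpairs-rotation nodePair (λ xy → proj₂ (proj₁ xy) ≡ proj₂ (proj₂ xy)) (λ _ → refl) nodePair-injective
      {as = as} {bs} (All.map link⇒edge≢ linked) eq₁ eq₂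

  record DynTrail : Set where
    field
      p     : ℕ
      v     : Fin (suc (suc p)) → Fin nV
      k     : Fin (suc p) → ℕ
      e     : (i : Fin (suc p)) → Fin (suc (k i)) → Fin nE
      joins : ∀ i j → Joins H G c (e i j) (v (inject₁ i)) (v (suc i))
      dyn   : ∀ (i : Fin p) → c (e (inject₁ i) (fromℕ (k (inject₁ i)))) ~ c (e (suc i) zero)
      trail : TableInjective e

    step : (i : Fin (suc p)) → Fin (suc (k i)) → Trav
    step i j = e i j , v (inject₁ i) , v (suc i)

    steps : List Trav
    steps = flattenTable step

    firstStep lastStep : Trav
    firstStep = step zero zero
    lastStep  = step (fromℕ p) (fromℕ (k (fromℕ p)))

    IsClosed : Set
    IsClosed = (v zero ≡ v (fromℕ (suc p)) × c (edge lastStep) ~ c (edge firstStep))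
             ⊎ (v (suc zero) ≡ v (fromℕ (suc p)) × Parallel H G c (edge lastStep) (edge firstStep))

    link⇒closed : Link lastStep firstStep → IsClosed
    link⇒closed (turn end≡start _ colours) = inj₁ (sym end≡start , colours)
    link⇒closed (parallel _ end≡end par)    = inj₂ (sym end≡end , par)

    closed⇒link : IsClosed → Link lastStep firstStep
    closed⇒link (inj₁ (v₀≡vₙ , colours)) = turn (sym v₀≡vₙ) last≢first colours
      where
      -- if the last edge were the first one, the last step would start at v₀ = vₙ, where it ends
      last≢first : edge lastStep ≢ edge firstStep
      last≢first eq = joins⇒≢ (joins (fromℕ p) (fromℕ (k (fromℕ p))))
        (trans (cong (v ∘ inject₁ ∘ proj₁) (trail (fromℕ p , _) (zero , zero) eq)) v₀≡vₙ)
    closed⇒link (inj₂ (v₁≡vₙ , par)) =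
      parallel (parallel-sameStart (joins (fromℕ p) _) (joins zero zero) par (sym v₁≡vₙ)) (sym v₁≡vₙ) par

    steps-circuit : Link lastStep firstStep → IsCircuit steps
    steps-circuit closing = record
      { traverse       = flattenTable-All⁺ joins
      ; edges-distinct = subst Unique (sym (map-flattenTable edge step)) (flattenTable-unique trail)
      ; linked         = subst (All (Related Link)) (sym (cycPairs-∷ _ _))
                           (table-walk p k step within between closing)
      }
      where
      within : ∀ i (j : Fin (k i)) → Link (step i (inject₁ j)) (step i (suc j))
      within i j = parallel refl refl
        (joins⇒parallel (joins i _) (joins i _) λ eq → inject₁≢suc j (Σ-injectiveʳ (trail (i , _) (i , _) eq)))
      between : ∀ (i : Fin p) → Link (step (inject₁ i) (fromℕ (k (inject₁ i)))) (step (suc i) zero)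
      between i = turn refl (λ eq → inject₁≢suc i (cong proj₁ (trail (inject₁ i , _) (suc i , zero) eq))) (dyn i)

  dynTrail : ClosedDynTrail H G c → DynTrail
  dynTrail T = record { ClosedDynTrail T }

  close : (W : DynTrail) → Link (DynTrail.lastStep W) (DynTrail.firstStep W) → ClosedDynTrail H G c
  close W closing = record { DynTrail W ; closed = DynTrail.link⇒closed W closing }

  traversals≡steps : ∀ T → traversals H G c T ≡ DynTrail.steps (dynTrail T)
  traversals≡steps T =
    cong concat (trans (map-tabulate id (λ i → map (step i) (allFin _)))
                       (tabulate-cong λ i → map-tabulate id (step i)))
    where open DynTrail (dynTrail T)

  circuitOf : ∀ T → IsCircuit (traversals H G c T)
  circuitOf T = subst IsCircuit (sym (traversals≡steps T)) (steps-circuit (closed⇒link (ClosedDynTrail.closed T)))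
    where open DynTrail (dynTrail T)

  module _ (W : DynTrail) {t : Trav} (jt : Traverses t) (fresh : ∀ i j → edge t ≢ DynTrail.e W i j) where
    open DynTrail W

    prependTurn : end t ≡ v zero → c (edge t) ~ c (e zero zero) → DynTrail
    prependTurn t→v₀ colours = record
      { p     = suc p
      ; v     = start t Vector.∷ v
      ; k     = 0 Vector.∷ k
      ; e     = newRow (edge t) e
      ; joins = λ where
          zero    zero → subst (Joins H G c (edge t) (start t)) t→v₀ jt
          (suc i) j    → joins i j
      ; dyn   = λ where
          zero    → colours
          (suc i) → dyn i
      ; trail = newRow-injective trail fresh
      }

    prependParallel : start t ≡ v zero → end t ≡ v (suc zero) → DynTrail
    prependParallel t→v₀ t→v₁ = record
      { p     = p
      ; v     = v
      ; k     = incFirst k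
      ; e     = consFirst (edge t) e
      ; joins = λ where
          zero    zero    → subst₂ (Joins H G c (edge t)) t→v₀ t→v₁ jt
          zero    (suc j) → joins zero j
          (suc i) j       → joins (suc i) j
      ; dyn   = λ where
          zero    → dyn zero
          (suc i) → dyn (suc i)
      ; trail = consFirst-injective trail fresh
      }

    lastStep-prependParallel : ∀ t→v₀ t→v₁ → DynTrail.lastStep (prependParallel t→v₀ t→v₁) ≡ lastStep
    lastStep-prependParallel _ _ = cong (_, _) (consFirst-last p (edge t) e)

  Realises : Trav → List Trav → Trav → Set
  Realises t us w = Σ DynTrail λ W → DynTrail.steps W ≡ t ∷ us × Link (DynTrail.lastStep W) w

  realise : ∀ {t us w} → Traverses t → All Traverses us → Unique (map edge (t ∷ us)) →
            All (Related Link) (walkEdges t us w) → Realises t us w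
  realise {t} {[]} jt [] _ (closing ∷ []) = single , refl , closing
    where
    single : DynTrail
    single = record
      { p = 0 ; v = start t Vector.∷ end t Vector.∷ Vector.[] ; k = λ _ → 0 ; e = λ _ _ → edge t
      ; joins = λ where zero zero → jt
      ; dyn = λ ()
      ; trail = λ where (zero , zero) (zero , zero) _ → refl
      }
  realise {t} {u ∷ us} jt (ju ∷ jus) (t∉us ∷ uniq) (link ∷ walk) with realise ju jus uniq walk
  ... | W , steps≡ , closing = extend link
    where
    open DynTrail W
    fresh : ∀ i j → edge t ≢ e i j
    fresh = flattenTable-All⁻ {F = step} (subst (All (λ u → edge t ≢ edge u)) (sym steps≡) (All.map⁻ t∉us))
    first≡u : firstStep ≡ u
    first≡u = ∷-injectiveˡ steps≡
    extend : Link t u → Realises t (u ∷ us) _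
    extend (turn t→u _ colours) =
      prependTurn W jt fresh (trans t→u (sym (cong start first≡u)))
                             (subst (λ x → c (edge t) ~ c (edge x)) (sym first≡u) colours) ,
      cong₂ _∷_ (cong (λ x → edge t , start t , x) (trans (cong start first≡u) (sym t→u))) steps≡ ,
      closing
    extend (parallel start≡ end≡ _) =
      prependParallel W jt fresh t→v₀ t→v₁ ,
      cong₂ _∷_ (cong₂ (λ a b → edge t , a , b) (sym t→v₀) (sym t→v₁)) steps≡ ,
      subst (λ s → Link s _) (sym (lastStep-prependParallel W jt fresh t→v₀ t→v₁)) closing
      where
      t→v₀ = trans start≡ (sym (cong start first≡u))
      t→v₁ = trans end≡ (sym (cong end first≡u))

  circuit⇒trail : ∀ {t ts} → IsCircuit (t ∷ ts) → Σ (ClosedDynTrail H G c) λ T → traversals H G c T ≡ t ∷ ts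
  circuit⇒trail {t} {ts} circuit with realise (All.head traverse) (All.tail traverse) edges-distinct
                                        (subst (All _) (cycPairs-∷ t ts) linked)
    where open IsCircuit circuit
  ... | W , steps≡ , closing =
    let closes = subst (Link _) (sym (∷-injectiveˡ steps≡)) closing
    in  close W closes , trans (traversals≡steps (close W closes)) steps≡

  cycleOf : ClosedDynTrail H G c → AltCycle H G c
  cycleOf T = proj₁ (altCycle (circuit⇒isAltCycle (circuitOf T)))

  cycleOf-nodes : ∀ T → map proj₁ (AltCycle.vs (cycleOf T)) ≡ nodes (traversals H G c T)
  cycleOf-nodes T = proj₂ (altCycle (circuit⇒isAltCycle (circuitOf T)))

  cycleOf-nodes-reverse : ∀ T →
    reverse (map proj₁ (AltCycle.vs (cycleOf T))) ≡ nodes (reverseTraversals H G c (traversals H G c T))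
  cycleOf-nodes-reverse T = trans (cong reverse (cycleOf-nodes T)) (nodes-reverse (traversals H G c T))

  cycleOf-cong : ∀ {T T′} → SameTrail H G c T T′ → SameCycle H G c (cycleOf T) (cycleOf T′)
  cycleOf-cong {T} {T′} (inj₁ r) =
    inj₁ (subst₂ Rotation (sym (cycleOf-nodes T)) (sym (cycleOf-nodes T′)) (rotation-nodes r))
  cycleOf-cong {T} {T′} (inj₂ r) =
    inj₂ (subst₂ Rotation (sym (cycleOf-nodes T)) (sym (cycleOf-nodes-reverse T′)) (rotation-nodes r))

  cycleOf-injective : ∀ {T T′} → SameCycle H G c (cycleOf T) (cycleOf T′) → SameTrail H G c T T′
  cycleOf-injective {T} {T′} (inj₁ r) =
    inj₁ (nodes-rotation (IsCircuit.linked (circuitOf T)) (subst₂ Rotation (cycleOf-nodes T) (cycleOf-nodes T′) r))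
  cycleOf-injective {T} {T′} (inj₂ r) =
    inj₂ (nodes-rotation (IsCircuit.linked (circuitOf T))
                         (subst₂ Rotation (cycleOf-nodes T) (cycleOf-nodes-reverse T′) r))

  cycleOf-surjective : ∀ C → Σ (ClosedDynTrail H G c) λ T → SameCycle H G c (cycleOf T) C
  cycleOf-surjective C with isAltCycle⇒rotatedCircuit (isAltCycle C)
  ... | t , ts , circuit , rotation with circuit⇒trail circuit
  ... | T , traversals≡ =
    T , inj₁ (rotation-sym (subst (Rotation _) (sym (trans (cycleOf-nodes T) (cong nodes traversals≡))) rotation))

theorem5 : (H : Graph) (G : MultiGraph) (c : Fin (MultiGraph.nE G) → Graph.V H) →
           QuotBijection (SameTrail H G c) (SameCycle H G c)
theorem5 H G c = record
  { to      = cycleOf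
  ; to-cong = λ {T} {T′} → cycleOf-cong {T} {T′}
  ; to-inj  = λ {T} {T′} → cycleOf-injective {T} {T′}
  ; to-surj = cycleOf-surjective
  }
  where open Correspondence H G c
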